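{- In the setting described in the context, let $n,m\in\mathbb N$ and let $Q=q_0\dots q_w$ be an $A_n$–$B_m$–coherent trail. If $n\ge1$ and $q_0\in A_n$, then $Q$ is $A_{n-1}$–$B_m$–coherent; and if $m\ge1$ and $q_w\in B_m$, then $Q$ is $A_n$–$B_{m-1}$–coherent.
   Context: All graphs are finite and simple; $[n]=\{1,\dots,n\}$, $[0,n]=\{0,\dots,n\}$, $\mathbb N=\{0,1,2,\dots\}$. A trail is a walk $q_0\dots q_w$ with distinct edges; a circuit is a closed trail. Setting: $G=(V,E)$ is a 2-edge-connected graph, $k\ge1$, $e_1,\dots,e_{k+1}$ are edges of $G$, $e_{k+1}=ab$, and $H$ is a shortest circuit in $G$ containing $e_1,\dots,e_k$, labelled in traversal order so that $H=H_1e_1H_2e_2\dots e_{k-1}H_ke_k$ with segments $H_1,\dots,H_k$; each $H_j$ is a path and $<_j$ is the order in which $H$ traverses $V(H_j)$. Subtrail: a trail $P=p_0\dots p_r$ is a subtrail of $Q=q_0\dots q_w$ with witnessing interval $I_P=\{t,\dots,t+r\}\subseteq[0,w]$ if $p_h=q_{t+h}$ for all $h\in[0,r]$, or $p_h=q_{t+r-h}$ for all $h\in[0,r]$ (the empty trail is a subtrail with empty witnessing interval). For $U\subseteq V$, $j\in[k]$: $\mathrm{Ins}_j(U)=U\cap V(H_j)$; $\mathrm{Cl}_j(U)$ is the subpath of $H_j$ from $\min_{<_j}\mathrm{Ins}_j(U)$ to $\max_{<_j}\mathrm{Ins}_j(U)$ (empty if $\mathrm{Ins}_j(U)=\emptyset$);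 $\mathrm{Cl}(U)=\bigcup_{j}V(\mathrm{Cl}_j(U))$. An $x$–$y$ trail $P$ is admissible if it lies in $G-E(H)-e_{k+1}$ and $V(P)\cap V(H)\subseteq\{x,y\}$ (trivial trails allowed). $\mathrm{Reach}(X)=\{y'\in V(H):\exists x'\in X$ with an admissible $x'$–$y'$ trail$\}$. $A_0=\emptyset$, $A_1=\mathrm{Reach}(\{a\})$, $A_{i+1}=\mathrm{Reach}(\mathrm{Cl}(A_i))$ for $i\ge1$; $B_i$ analogously with $b$. For $n,m\in\mathbb N$, a trail $Q=q_0\dots q_w$ is $A_n$–$B_m$–coherent if: (C1) $e_1,\dots,e_k\in E(Q)$, $q_0\in A_{n+1}$ and $q_w\in B_{m+1}$; (C2) for every $s\in[w]$ with $q_{s-1}q_s\in E\setminus E(H)$ there are $r,t\in[0,w]$ with $r<s\le t$, $q_r,q_t\in V(H)$, such that $q_r\dots q_t$ (the part of $Q$ between indices $r$ and $t$) is an admissible $q_r$–$q_t$ trail, and each of $A_{n+1}$ and $B_{m+1}$ contains at most one of $q_r,q_t$; (C3) for every $j\in[k]$, $\mathrm{Cl}_j(A_n)$ and $\mathrm{Cl}_j(B_m)$ are subtrails of $Q$ with witnessing intervals $I_{A_n,j}$ and $I_{B_m,j}$ such that $I_{X,j}\cap I_{Y,j'}=\emptyset$ for all $X,Y\in\{A_n,B_m\}$ and all distinct $j\neq j'$ in $[k]$. -}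

module Defs where

open import Data.Nat using (ℕ; zero; suc; _+_; _∸_; _≤_; _<_)
open import Data.Fin using (Fin)
open import Data.Bool using (Bool; T; false)
open import Data.Maybe using (Maybe; just; nothing)
open import Data.Product using (Σ; ∃; ∃-syntax; _×_; _,_)
open import Data.Sum using (_⊎_)
open import Data.Empty using (⊥)
open import Relation.Nullary using (¬_)
open import Relation.Binary.PropositionalEquality using (_≡_; _≢_)

record SimpleGraph : Set where
  field
    N          : ℕ
    adj        : Fin N → Fin N → Bool
    adj-sym    : ∀ u v → adj u v ≡ adj v u
    adj-irrefl : ∀ u → adj u u ≡ false

module GraphNotions (G : SimpleGraph) where
  open SimpleGraph G

  Vtx : Set
  Vtx = Fin N

  Adj : Vtx → Vtx → Set
  Adj u v = T (adj u v)

  -- an (unordered) edge is given by its two endpoints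
  Edge : Set
  Edge = Vtx × Vtx

  SameEdge : Edge → Edge → Set
  SameEdge (u , v) (u' , v') = (u ≡ u' × v ≡ v') ⊎ (u ≡ v' × v ≡ u')

  -- A walk q_0 … q_w is given by w and q : ℕ → Vtx (only q 0 … q w matter).
  EdgeAt : (ℕ → Vtx) → ℕ → Edge
  EdgeAt q s = (q s , q (suc s))

  IsWalk : ℕ → (ℕ → Vtx) → Set
  IsWalk w q = ∀ s → s < w → Adj (q s) (q (suc s))

  IsTrail : ℕ → (ℕ → Vtx) → Set
  IsTrail w q = IsWalk w q ×
    (∀ s s' → s < w → s' < w → SameEdge (EdgeAt q s) (EdgeAt q s') → s ≡ s')

  InE : ℕ → (ℕ → Vtx) → Edge → Set
  InE w q e = ∃[ s ] (s < w × SameEdge (EdgeAt q s) e)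

  Connected : Set
  Connected = ∀ x y → ∃[ w ] ∃[ q ] (IsWalk w q × q 0 ≡ x × q w ≡ y)

  Bridgeless : Set
  Bridgeless = ∀ u v → Adj u v → ∀ x y →
    ∃[ w ] ∃[ q ] (IsWalk w q × q 0 ≡ x × q w ≡ y × ¬ InE w q (u , v))

  TwoEdgeConnected : Set
  TwoEdgeConnected = Connected × Bridgeless

-- start index of segment j (0-based) given the end indices τ
start : (ℕ → ℕ) → ℕ → ℕ
start τ zero    = zero
start τ (suc j) = suc (τ j)

-- The setting.  H = h 0 … h L (h L = h 0) is a circuit; segment H_{j+1}
-- (j = 0 … k-1, 0-based) is h (start τ j) … h (τ j), and e_{j+1} is the
-- edge h (τ j) h (τ j + 1).  e_{k+1} = ab.

record Setting (G : SimpleGraph) : Set where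
  open GraphNotions G
  field
    twoEdgeConn : TwoEdgeConnected
    k       : ℕ
    k≥1     : 1 ≤ k
    L       : ℕ
    h       : ℕ → Vtx
    H-trail : IsTrail L h
    H-closed : h 0 ≡ h L
    τ       : ℕ → ℕ
    seg-nonempty : ∀ j → j < k → start τ j ≤ τ j
    seg-closing  : suc (τ (k ∸ 1)) ≡ L
    seg-path : ∀ j → j < k → ∀ i i' → start τ j ≤ i → i ≤ τ j →
               start τ j ≤ i' → i' ≤ τ j → h i ≡ h i' → i ≡ i'
    H-shortest : ∀ w q → IsTrail w q → q 0 ≡ q w →
                 (∀ j → j < k → InE w q (EdgeAt h (τ j))) → L ≤ w
    a b     : Vtx
    ab-edge : Adj a b

module SettingNotions {G : SimpleGraph} (S : Setting G) where
  open GraphNotions G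
  open Setting S

  Pred : Set₁
  Pred = Vtx → Set

  VH : Pred
  VH v = ∃[ i ] (i ≤ L × h i ≡ v)

  EH : Edge → Set
  EH e = InE L h e

  AdmissibleSeq : ℕ → (ℕ → Vtx) → Set
  AdmissibleSeq w q = IsTrail w q ×
    (∀ s → s < w → ¬ EH (EdgeAt q s) × ¬ SameEdge (EdgeAt q s) (a , b)) ×
    (∀ i → i ≤ w → VH (q i) → q i ≡ q 0 ⊎ q i ≡ q w)

  Admissible : Vtx → Vtx → Set
  Admissible x y = ∃[ w ] ∃[ q ] (AdmissibleSeq w q × q 0 ≡ x × q w ≡ y)

  Reach : Pred → Pred
  Reach X y = VH y × ∃[ x ] (X x × Admissible x y)

  -- Ins_j(U), as the set of indices of H_j (order <_j = index order)
  Ins : ℕ → Pred → ℕ → Set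
  Ins j U i = start τ j ≤ i × i ≤ τ j × U (h i)

  IsMinIns : ℕ → Pred → ℕ → Set
  IsMinIns j U lo = Ins j U lo × (∀ i → Ins j U i → lo ≤ i)

  IsMaxIns : ℕ → Pred → ℕ → Set
  IsMaxIns j U hi = Ins j U hi × (∀ i → Ins j U i → i ≤ hi)

  -- Cl(U) = ⋃_j V(Cl_j(U)),  Cl_j(U) = h lo … h hi
  Cl : Pred → Pred
  Cl U v = ∃[ j ] (j < k × ∃[ lo ] ∃[ hi ] ∃[ i ]
             (IsMinIns j U lo × IsMaxIns j U hi × lo ≤ i × i ≤ hi × h i ≡ v))

  Iter : Vtx → ℕ → Pred
  Iter c zero          = λ _ → ⊥
  Iter c (suc zero)    = Reach (λ v → v ≡ c)
  Iter c (suc (suc i)) = Reach (Cl (Iter c (suc i)))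

  A : ℕ → Pred
  A = Iter a

  B : ℕ → Pred
  B = Iter b

  Interval : Set
  Interval = Maybe (ℕ × ℕ)

  InI : Interval → ℕ → Set
  InI nothing        i = ⊥
  InI (just (t , r)) i = t ≤ i × i ≤ t + r

  Disjoint : Interval → Interval → Set
  Disjoint I J = ∀ i → InI I i → InI J i → ⊥

  ClSubtrail : ℕ → Pred → ℕ → (ℕ → Vtx) → Interval → Set
  ClSubtrail j U w q I =
    ((∀ i → ¬ Ins j U i) × I ≡ nothing) ⊎
    (∃[ lo ] ∃[ hi ] ∃[ t ]
      (IsMinIns j U lo × IsMaxIns j U hi × I ≡ just (t , hi ∸ lo) ×
       t + (hi ∸ lo) ≤ w ×
       ((∀ d → d ≤ hi ∸ lo → h (lo + d) ≡ q (t + d)) ⊎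
        (∀ d → d ≤ hi ∸ lo → h (lo + d) ≡ q (t + (hi ∸ lo) ∸ d)))))

  C1 : ℕ → ℕ → ℕ → (ℕ → Vtx) → Set
  C1 n m w q = (∀ j → j < k → InE w q (EdgeAt h (τ j))) ×
               A (suc n) (q 0) × B (suc m) (q w)

  C2 : ℕ → ℕ → ℕ → (ℕ → Vtx) → Set
  C2 n m w q = ∀ s → 1 ≤ s → s ≤ w → ¬ EH (q (s ∸ 1) , q s) →
    ∃[ r ] ∃[ t ] (r < s × s ≤ t × t ≤ w × VH (q r) × VH (q t) ×
      AdmissibleSeq (t ∸ r) (λ i → q (r + i)) ×
      ¬ (A (suc n) (q r) × A (suc n) (q t)) ×
      ¬ (B (suc m) (q r) × B (suc m) (q t)))

  C3 : ℕ → ℕ → ℕ → (ℕ → Vtx) → Set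
  C3 n m w q = Σ (ℕ → Interval) λ IA → Σ (ℕ → Interval) λ IB →
    ((∀ j → j < k → ClSubtrail j (A n) w q (IA j) × ClSubtrail j (B m) w q (IB j)) ×
     (∀ j j' → j < k → j' < k → j ≢ j' →
        Disjoint (IA j) (IA j') × Disjoint (IA j) (IB j') ×
        Disjoint (IB j) (IA j') × Disjoint (IB j) (IB j')))

  Coherent : ℕ → ℕ → ℕ → (ℕ → Vtx) → Set
  Coherent n m w q = IsTrail w q × C1 n m w q × C2 n m w q × C3 n m w q

module Submission where

-- The proof rests on a single monotonicity fact,
-- A_{i} ⊆ A_{i+1} (and likewise for B):
--   * (C1) for the lowered index is exactly the hypothesis q_0 ∈ A_n;
--   * (C2) only becomes weaker when the end-point classes shrink;
--   * (C3): since A_{n-1} ⊆ A_n, each closure path Cl_j(A_{n-1}) is a subpath of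
--     Cl_j(A_n), so it is traced by a sub-interval of the interval witnessing
--     Cl_j(A_n); sub-intervals of pairwise disjoint intervals stay disjoint.
-- Monotonicity of the iteration uses U ⊆ Cl(U) and monotonicity of Cl, and both need
-- the extreme points of Ins_j(U), i.e. the decidability of the sets A_i, B_i.  That in
-- turn rests on deciding admissible reachability: a trail has at most N² edges, and
-- a prefix-determined property of sequences over a finite alphabet is decidable.

open import Defs
open import Data.Nat using (ℕ; zero; suc; _+_; _*_; _∸_; _≤_; _<_; z≤n; s≤s; z<s; _≤?_; _<?_)
open import Data.Nat.Properties
open import Data.Nat.Tactic.RingSolver using (solve-∀)
open import Data.Fin using (Fin; toℕ; combine)
import Data.Fin.Properties as Fin
open import Data.Bool.Properties using (T?)
open import Data.Maybe using (just; nothing)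
open import Data.Product
open import Data.Sum using (_⊎_; inj₁; inj₂)
open import Data.Empty using (⊥-elim)
open import Relation.Nullary
open import Relation.Nullary.Decidable using (_×-dec_; _⊎-dec_; _→-dec_; ¬?; map′)
open import Relation.Unary using (Decidable; _⊆_)
open import Relation.Binary.PropositionalEquality

≤-suc-cases : ∀ {i B} → i ≤ suc B → i ≤ B ⊎ i ≡ suc B
≤-suc-cases i≤1+B with m≤n⇒m<n∨m≡n i≤1+B
... | inj₁ i<1+B = inj₁ (≤-pred i<1+B)
... | inj₂ i≡1+B = inj₂ i≡1+B

module BoundedSearch {P : ℕ → Set} (P? : Decidable P) where

  all<? : ∀ w → Dec (∀ s → s < w → P s)
  all<? w = map′ (λ f s → f {s}) (λ f {s} → f s) (allUpTo? P? w)

  all≤? : ∀ w → Dec (∀ s → s ≤ w → P s)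
  all≤? w = map′ (λ f s s≤w → f s (s≤s s≤w)) (λ f s s<1+w → f s (≤-pred s<1+w)) (all<? (suc w))

  any<? : ∀ w → Dec (∃[ s ] (s < w × P s))
  any<? = anyUpTo? P?

  any≤? : ∀ w → Dec (∃[ s ] (s ≤ w × P s))
  any≤? w = map′ (λ (s , s<1+w , p) → s , ≤-pred s<1+w , p)
                 (λ (s , s≤w , p) → s , s≤s s≤w , p) (any<? (suc w))

  none-step : ∀ {B} → (∀ i → i ≤ B → ¬ P i) → ¬ P (suc B) → ∀ i → i ≤ suc B → ¬ P i
  none-step none ¬p i i≤1+B with ≤-suc-cases i≤1+B
  ... | inj₁ i≤B = none i i≤B
  ... | inj₂ refl = ¬p

  least : ∀ B → (∀ i → i ≤ B → ¬ P i) ⊎ ∃[ lo ] (P lo × ∀ i → P i → lo ≤ i)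
  least zero with P? 0
  ... | yes p = inj₂ (0 , p , λ _ _ → z≤n)
  ... | no ¬p = inj₁ λ { zero _ → ¬p ; (suc i) () }
  least (suc B) with least B
  ... | inj₂ witness = inj₂ witness
  ... | inj₁ none with P? (suc B)
  ...   | yes p = inj₂ (suc B , p , above)
    where
    above : ∀ i → P i → suc B ≤ i
    above i pᵢ with i ≤? B
    ... | yes i≤B = ⊥-elim (none i i≤B pᵢ)
    ... | no i≰B = ≰⇒> i≰B
  ...   | no ¬p = inj₁ (none-step none ¬p)

  greatest : ∀ B → (∀ i → i ≤ B → ¬ P i) ⊎ ∃[ hi ] (P hi × ∀ i → i ≤ B → P i → i ≤ hi)
  greatest zero with P? 0
  ... | yes p = inj₂ (0 , p , λ _ i≤0 _ → i≤0)
  ... | no ¬p = inj₁ λ { zero _ → ¬p ; (suc i) () }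
  greatest (suc B) with P? (suc B)
  ... | yes p = inj₂ (suc B , p , λ _ i≤1+B _ → i≤1+B)
  ... | no ¬p with greatest B
  ...   | inj₁ none = inj₁ (none-step none ¬p)
  ...   | inj₂ (hi , p , below) = inj₂ (hi , p , below′)
    where
    below′ : ∀ i → i ≤ suc B → P i → i ≤ hi
    below′ i i≤1+B pᵢ with ≤-suc-cases i≤1+B
    ... | inj₁ i≤B = below i i≤B pᵢ
    ... | inj₂ refl = ⊥-elim (¬p pᵢ)

  extremal : ∀ B → (∀ i → P i → i ≤ B) →
    (∀ i → ¬ P i) ⊎ ((∃[ lo ] (P lo × ∀ i → P i → lo ≤ i)) × (∃[ hi ] (P hi × ∀ i → P i → i ≤ hi)))
  extremal B bounded with least B
  ... | inj₁ none = inj₁ λ i pᵢ → none i (bounded i pᵢ) pᵢ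
  ... | inj₂ (lo , pₗₒ , ≥lo) with greatest B
  ...   | inj₁ none = ⊥-elim (none lo (bounded lo pₗₒ) pₗₒ)
  ...   | inj₂ (hi , pₕᵢ , ≤hi) = inj₂ ((lo , pₗₒ , ≥lo) , (hi , pₕᵢ , λ i pᵢ → ≤hi i (bounded i pᵢ) pᵢ))

open BoundedSearch

_◂_ : {X : Set} → X → (ℕ → X) → ℕ → X
(x ◂ f) zero    = x
(x ◂ f) (suc i) = f i

PrefixDetermined : {X : Set} → ℕ → ((ℕ → X) → Set) → Set
PrefixDetermined {X} w P = ∀ (q q′ : ℕ → X) → (∀ i → i ≤ w → q i ≡ q′ i) → P q → P q′

prefix-tail : {X : Set} {w : ℕ} {P : (ℕ → X) → Set} →
  PrefixDetermined (suc w) P → ∀ x → PrefixDetermined w (λ q → P (x ◂ q))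
prefix-tail local x q q′ agree = local (x ◂ q) (x ◂ q′) λ { zero _ → refl ; (suc i) (s≤s i≤w) → agree i i≤w }

sequence-search : {n : ℕ} (w : ℕ) {P : (ℕ → Fin n) → Set} →
  PrefixDetermined w P → Decidable P → Dec (∃ P)
sequence-search zero {P} local P? with Fin.any? (λ x → P? (λ _ → x))
... | yes (x , p) = yes (_ , p)
... | no ¬const = no λ (q , p) → ¬const (q 0 , local q (λ _ → q 0) (λ { zero _ → refl }) p)
sequence-search (suc w) {P} local P?
  with Fin.any? (λ x → sequence-search w (prefix-tail local x) (λ q → P? (x ◂ q)))
... | yes (x , q , p) = yes (x ◂ q , p)
... | no ¬found = no λ (q , p) →
        ¬found (q 0 , (λ i → q (suc i)) , local q _ (λ { zero _ → refl ; (suc i) _ → refl }) p)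

-- The sequence q traces p_lo … p_{lo+len} on the interval [t, t + len],
-- forwards or backwards; this is the shape of the subtrail condition (C3).
Traces : {V : Set} → (ℕ → V) → ℕ → ℕ → (ℕ → V) → ℕ → Set
Traces p lo len q t =
  (∀ d → d ≤ len → p (lo + d) ≡ q (t + d)) ⊎ (∀ d → d ≤ len → p (lo + d) ≡ q (t + len ∸ d))

traces-restrict : {V : Set} (p q : ℕ → V) (lo d₀ l e t : ℕ) →
  Traces p lo (d₀ + l + e) q t →
  ∃[ t′ ] (Traces p (lo + d₀) l q t′ × t ≤ t′ × t′ + l ≤ t + (d₀ + l + e))
traces-restrict p q lo d₀ l e t (inj₁ forwards) =
  t + d₀ , inj₁ section , m≤m+n t d₀ , end-bound
  where
  open ≡-Reasoning
  section : ∀ d → d ≤ l → p (lo + d₀ + d) ≡ q (t + d₀ + d)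
  section d d≤l = begin
    p (lo + d₀ + d)   ≡⟨ cong p (+-assoc lo d₀ d) ⟩
    p (lo + (d₀ + d)) ≡⟨ forwards (d₀ + d) (≤-trans (+-monoʳ-≤ d₀ d≤l) (m≤m+n (d₀ + l) e)) ⟩
    q (t + (d₀ + d))  ≡⟨ cong q (sym (+-assoc t d₀ d)) ⟩
    q (t + d₀ + d)    ∎
  end-bound : t + d₀ + l ≤ t + (d₀ + l + e)
  end-bound = subst (_≤ t + (d₀ + l + e)) (sym (+-assoc t d₀ l)) (+-monoʳ-≤ t (m≤m+n (d₀ + l) e))
traces-restrict p q lo d₀ l e t (inj₂ backwards) =
  t + e , inj₂ section , m≤m+n t e , subst (t + e + l ≤_) (sym total) (m≤n+m (t + e + l) d₀)
  where
  open ≡-Reasoning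
  rearrange : ∀ x y z u → x + (y + z + u) ≡ y + (x + u + z)
  rearrange = solve-∀
  total : t + (d₀ + l + e) ≡ d₀ + (t + e + l)
  total = rearrange t d₀ l e
  section : ∀ d → d ≤ l → p (lo + d₀ + d) ≡ q (t + e + l ∸ d)
  section d d≤l = begin
    p (lo + d₀ + d)                    ≡⟨ cong p (+-assoc lo d₀ d) ⟩
    p (lo + (d₀ + d))                  ≡⟨ backwards (d₀ + d) (≤-trans (+-monoʳ-≤ d₀ d≤l) (m≤m+n (d₀ + l) e)) ⟩
    q (t + (d₀ + l + e) ∸ (d₀ + d))    ≡⟨ cong (λ x → q (x ∸ (d₀ + d))) total ⟩
    q (d₀ + (t + e + l) ∸ (d₀ + d))    ≡⟨ cong q ([m+n]∸[m+o]≡n∸o d₀ (t + e + l) d) ⟩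
    q (t + e + l ∸ d)                  ∎

traces-sub : {V : Set} (p q : ℕ → V) {lo₀ lo hi hi₀ t : ℕ} →
  lo₀ ≤ lo → lo ≤ hi → hi ≤ hi₀ → Traces p lo₀ (hi₀ ∸ lo₀) q t →
  ∃[ t′ ] (Traces p lo (hi ∸ lo) q t′ × t ≤ t′ × t′ + (hi ∸ lo) ≤ t + (hi₀ ∸ lo₀))
traces-sub p q {lo₀} {t = t} lo₀≤lo lo≤hi hi≤hi₀ traced
  with d₀ , refl ← m≤n⇒∃[o]m+o≡n lo₀≤lo
     | l  , refl ← m≤n⇒∃[o]m+o≡n lo≤hi
     | e  , refl ← m≤n⇒∃[o]m+o≡n hi≤hi₀
  rewrite m+n∸m≡n (lo₀ + d₀) l
        | +-assoc lo₀ d₀ l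
        | +-assoc lo₀ (d₀ + l) e
        | m+n∸m≡n lo₀ (d₀ + l + e)
  = traces-restrict p q lo₀ d₀ l e t traced

module TrailFacts (G : SimpleGraph) where
  open SimpleGraph G
  open GraphNotions G

  adj? : ∀ u v → Dec (Adj u v)
  adj? u v = T? (adj u v)

  sameEdge? : ∀ e e′ → Dec (SameEdge e e′)
  sameEdge? (u , v) (u′ , v′) =
    ((u Fin.≟ u′) ×-dec (v Fin.≟ v′)) ⊎-dec ((u Fin.≟ v′) ×-dec (v Fin.≟ u′))

  inE? : ∀ w q e → Dec (InE w q e)
  inE? w q e = any<? (λ s → sameEdge? (EdgeAt q s) e) w

  trail? : ∀ w q → Dec (IsTrail w q)
  trail? w q = all<? (λ s → adj? (q s) (q (suc s))) w ×-dec
    map′ (λ f s s′ s<w s′<w → f s s<w s′ s′<w) (λ f s s<w s′ s′<w → f s s′ s<w s′<w)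
      (all<? (λ s → all<? (λ s′ → sameEdge? (EdgeAt q s) (EdgeAt q s′) →-dec (s ≟ s′)) w) w)

  -- A trail uses distinct ordered pairs of vertices as its edges, so it has at most N² edges.
  trail-length-bound : ∀ w q → IsTrail w q → w ≤ N * N
  trail-length-bound w q (_ , distinct) with w ≤? N * N
  ... | yes w≤N² = w≤N²
  ... | no w≰N² with Fin.pigeonhole (≰⇒> w≰N²) (λ s → combine (q (toℕ s)) (q (suc (toℕ s))))
  ...   | (i , j , i<j , same) with Fin.combine-injective _ _ _ _ same
  ...     | (tail≡ , head≡) = ⊥-elim (<-irrefl
            (distinct (toℕ i) (toℕ j) (Fin.toℕ<n i) (Fin.toℕ<n j) (inj₁ (tail≡ , head≡))) i<j)

module Coherence {G : SimpleGraph} (S : Setting G) where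
  open GraphNotions G
  open Setting S
  open SettingNotions S
  open TrailFacts G

  admissible-prefix : ∀ w x y → PrefixDetermined w (λ q → AdmissibleSeq w q × q 0 ≡ x × q w ≡ y)
  admissible-prefix w x y q q′ agree (((walk , distinct) , avoids , inner) , q₀≡x , q_w≡y) =
    ((walk′ , distinct′) , avoids′ , inner′) ,
    trans (sym (agree 0 z≤n)) q₀≡x , trans (sym (agree w ≤-refl)) q_w≡y
    where
    edge≡ : ∀ s → s < w → EdgeAt q s ≡ EdgeAt q′ s
    edge≡ s s<w = cong₂ _,_ (agree s (<⇒≤ s<w)) (agree (suc s) s<w)
    walk′ : IsWalk w q′
    walk′ s s<w = subst₂ Adj (agree s (<⇒≤ s<w)) (agree (suc s) s<w) (walk s s<w)
    distinct′ : ∀ s s′ → s < w → s′ < w → SameEdge (EdgeAt q′ s) (EdgeAt q′ s′) → s ≡ s′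
    distinct′ s s′ s<w s′<w same =
      distinct s s′ s<w s′<w (subst₂ SameEdge (sym (edge≡ s s<w)) (sym (edge≡ s′ s′<w)) same)
    avoids′ : ∀ s → s < w → ¬ EH (EdgeAt q′ s) × ¬ SameEdge (EdgeAt q′ s) (a , b)
    avoids′ s s<w = subst (λ e → ¬ EH e × ¬ SameEdge e (a , b)) (edge≡ s s<w) (avoids s s<w)
    inner′ : ∀ i → i ≤ w → VH (q′ i) → q′ i ≡ q′ 0 ⊎ q′ i ≡ q′ w
    inner′ i i≤w rewrite sym (agree i i≤w) | sym (agree 0 z≤n) | sym (agree w ≤-refl) = inner i i≤w

  VH? : Decidable VH
  VH? v = any≤? (λ i → h i Fin.≟ v) L

  EH? : Decidable EH
  EH? = inE? L h

  admissibleSeq? : ∀ w → Decidable (AdmissibleSeq w)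
  admissibleSeq? w q = trail? w q ×-dec
    all<? (λ s → ¬? (EH? (EdgeAt q s)) ×-dec ¬? (sameEdge? (EdgeAt q s) (a , b))) w ×-dec
    all≤? (λ i → VH? (q i) →-dec ((q i Fin.≟ q 0) ⊎-dec (q i Fin.≟ q w))) w

  -- Admissible reachability is decidable: a witnessing trail has length at most N²,
  -- and for each length the candidate sequences can be searched exhaustively.
  admissible? : ∀ x y → Dec (Admissible x y)
  admissible? x y =
    map′ (λ (w , _ , found) → w , found)
         (λ (w , q , adm) → w , trail-length-bound w q (proj₁ (proj₁ adm)) , q , adm)
         (any≤? (λ w → sequence-search w (admissible-prefix w x y)
                         (λ q → admissibleSeq? w q ×-dec (q 0 Fin.≟ x) ×-dec (q w Fin.≟ y)))
                (SimpleGraph.N G * SimpleGraph.N G))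

  reach? : ∀ {X} → Decidable X → Decidable (Reach X)
  reach? X? y = VH? y ×-dec Fin.any? (λ x → X? x ×-dec admissible? x y)

  ins? : ∀ j {U} → Decidable U → Decidable (Ins j U)
  ins? j U? i = (start τ j ≤? i) ×-dec (i ≤? τ j) ×-dec U? (h i)

  ins-mono : ∀ j {U U′} → U ⊆ U′ → Ins j U ⊆ Ins j U′
  ins-mono _ U⊆U′ (start≤i , i≤τ , u) = start≤i , i≤τ , U⊆U′ u

  ins-extremal : ∀ j {U} → Decidable U →
    (∀ i → ¬ Ins j U i) ⊎ ((∃[ lo ] IsMinIns j U lo) × (∃[ hi ] IsMaxIns j U hi))
  ins-extremal j U? = extremal (ins? j U?) (τ j) (λ i (_ , i≤τ , _) → i≤τ)

  cl? : ∀ {U} → Decidable U → Decidable (Cl U)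
  cl? {U} U? v = any<? onSegment? k
    where
    OnSegment : ℕ → Set
    OnSegment j = ∃[ lo ] ∃[ hi ] ∃[ i ] (IsMinIns j U lo × IsMaxIns j U hi × lo ≤ i × i ≤ hi × h i ≡ v)
    onSegment? : Decidable OnSegment
    onSegment? j with ins-extremal j U?
    ... | inj₁ none = no λ (lo , _ , _ , (insₗₒ , _) , _) → none lo insₗₒ
    ... | inj₂ ((lo , min) , (hi , max)) with any≤? (λ i → (lo ≤? i) ×-dec (h i Fin.≟ v)) hi
    ...   | yes (i , i≤hi , lo≤i , hᵢ≡v) = yes (lo , hi , i , min , max , lo≤i , i≤hi , hᵢ≡v)
    ...   | no ¬between = no λ (lo′ , hi′ , i , min′ , max′ , lo′≤i , i≤hi′ , hᵢ≡v) →
              ¬between (i , ≤-trans i≤hi′ (proj₂ max hi′ (proj₁ max′)) ,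
                         ≤-trans (proj₂ min lo′ (proj₁ min′)) lo′≤i , hᵢ≡v)

  iter? : ∀ c i → Decidable (Iter c i)
  iter? c zero          _ = no λ ()
  iter? c (suc zero)      = reach? (λ x → x Fin.≟ c)
  iter? c (suc (suc i))   = reach? (cl? (iter? c (suc i)))

  iter⊆VH : ∀ c i → Iter c i ⊆ VH
  iter⊆VH c (suc zero)    = proj₁
  iter⊆VH c (suc (suc i)) = proj₁

  segment-of : ∀ j → j < k → ∀ i → i ≤ τ j → ∃[ j′ ] (j′ < k × start τ j′ ≤ i × i ≤ τ j′)
  segment-of zero    j<k i i≤τ = 0 , j<k , z≤n , i≤τ
  segment-of (suc j) j<k i i≤τ with i ≤? τ j
  ... | yes i≤τ′ = segment-of j (<⇒≤ j<k) i i≤τ′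
  ... | no i≰τ′ = suc j , j<k , ≰⇒> i≰τ′ , i≤τ

  VH-on-segment : ∀ {v} → VH v → ∃[ j ] (j < k × ∃[ i ] (start τ j ≤ i × i ≤ τ j × h i ≡ v))
  VH-on-segment (i , i≤L , hᵢ≡v) with m≤n⇒m<n∨m≡n i≤L
  ... | inj₂ refl = 0 , k≥1 , 0 , z≤n , z≤n , trans H-closed hᵢ≡v
  ... | inj₁ i<L with segment-of (k ∸ 1) (∸-monoʳ-< z<s k≥1) i (≤-pred (subst (suc i ≤_) (sym seg-closing) i<L))
  ...   | j , j<k , start≤i , i≤τ = j , j<k , i , start≤i , i≤τ , hᵢ≡v

  cl-extensive : ∀ {U} → Decidable U → U ⊆ VH → U ⊆ Cl U
  cl-extensive {U} U? U⊆VH {v} u with VH-on-segment (U⊆VH u)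
  ... | j , j<k , i , start≤i , i≤τ , hᵢ≡v with ins-extremal j U?
  ...   | inj₁ none = ⊥-elim (none i insᵢ)
    where insᵢ = start≤i , i≤τ , subst U (sym hᵢ≡v) u
  ...   | inj₂ ((lo , min) , (hi , max)) =
          j , j<k , lo , hi , i , min , max , proj₂ min i insᵢ , proj₂ max i insᵢ , hᵢ≡v
    where insᵢ = start≤i , i≤τ , subst U (sym hᵢ≡v) u

  cl-mono : ∀ {U U′} → Decidable U′ → U ⊆ U′ → Cl U ⊆ Cl U′
  cl-mono {U} {U′} U′? U⊆U′ (j , j<k , lo , hi , i , (insₗₒ , _) , (insₕᵢ , _) , lo≤i , i≤hi , hᵢ≡v)
    with ins-extremal j U′?
  ... | inj₁ none = ⊥-elim (none lo (ins-mono j {U} {U′} U⊆U′ insₗₒ))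
  ... | inj₂ ((lo′ , min′) , (hi′ , max′)) =
        j , j<k , lo′ , hi′ , i , min′ , max′ ,
        ≤-trans (proj₂ min′ lo (ins-mono j {U} {U′} U⊆U′ insₗₒ)) lo≤i ,
        ≤-trans i≤hi (proj₂ max′ hi (ins-mono j {U} {U′} U⊆U′ insₕᵢ)) , hᵢ≡v

  reach-mono : ∀ {X X′} → X ⊆ X′ → Reach X ⊆ Reach X′
  reach-mono X⊆X′ (vh , x , x∈X , adm) = vh , x , X⊆X′ x∈X , adm

  -- The trivial trail shows that every vertex of H in X is reachable from X.
  reach-trivial : ∀ {X v} → X v → VH v → Reach X v
  reach-trivial {v = v} x∈X vh =
    vh , v , x∈X , 0 , (λ _ → v) ,
    (((λ _ ()) , (λ _ _ ())) , (λ _ ()) , (λ _ _ _ → inj₁ refl)) , refl , refl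

  iter-mono : ∀ c i → Iter c i ⊆ Iter c (suc i)
  iter-mono c zero          ()
  iter-mono c (suc zero)    r = reach-trivial (cl-extensive (iter? c 1) (iter⊆VH c 1) r) (proj₁ r)
  iter-mono c (suc (suc i))   = reach-mono (cl-mono (iter? c (suc (suc i))) (iter-mono c (suc i)))

  -- Conditions (C2) and (C3) with the classes A_{n+1}, B_{m+1} (resp. A_n, B_m)
  -- replaced by arbitrary vertex sets X, Y: C2 n m w q is C2For (A (suc n)) (B (suc m)) w q
  -- and C3 n m w q is C3For (A n) (B m) w q, by definition.
  C2For : Pred → Pred → ℕ → (ℕ → Vtx) → Set
  C2For X Y w q = ∀ s → 1 ≤ s → s ≤ w → ¬ EH (q (s ∸ 1) , q s) →
    ∃[ r ] ∃[ t ] (r < s × s ≤ t × t ≤ w × VH (q r) × VH (q t) ×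
      AdmissibleSeq (t ∸ r) (λ i → q (r + i)) ×
      ¬ (X (q r) × X (q t)) × ¬ (Y (q r) × Y (q t)))

  C3For : Pred → Pred → ℕ → (ℕ → Vtx) → Set
  C3For X Y w q = Σ (ℕ → Interval) λ IX → Σ (ℕ → Interval) λ IY →
    ((∀ j → j < k → ClSubtrail j X w q (IX j) × ClSubtrail j Y w q (IY j)) ×
     (∀ j j′ → j < k → j′ < k → j ≢ j′ →
        Disjoint (IX j) (IX j′) × Disjoint (IX j) (IY j′) ×
        Disjoint (IY j) (IX j′) × Disjoint (IY j) (IY j′)))

  -- (C2) survives shrinking the end-point classes: fewer pairs have both ends in them.
  c2-shrink : ∀ {X X′ Y Y′ w q} → X ⊆ X′ → Y ⊆ Y′ → C2For X′ Y′ w q → C2For X Y w q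
  c2-shrink X⊆X′ Y⊆Y′ c2 s 1≤s s≤w off-H with c2 s 1≤s s≤w off-H
  ... | r , t , r<s , s≤t , t≤w , vhᵣ , vhₜ , adm , ¬bothX′ , ¬bothY′ =
        r , t , r<s , s≤t , t≤w , vhᵣ , vhₜ , adm ,
        (λ (xᵣ , xₜ) → ¬bothX′ (X⊆X′ xᵣ , X⊆X′ xₜ)) , (λ (yᵣ , yₜ) → ¬bothY′ (Y⊆Y′ yᵣ , Y⊆Y′ yₜ))

  _⊆ᴵ_ : Interval → Interval → Set
  I ⊆ᴵ J = ∀ i → InI I i → InI J i

  disjoint-mono : ∀ {I I′ J J′} → I ⊆ᴵ I′ → J ⊆ᴵ J′ → Disjoint I′ J′ → Disjoint I J
  disjoint-mono I⊆I′ J⊆J′ disjoint i i∈I i∈J = disjoint i (I⊆I′ i i∈I) (J⊆J′ i i∈J)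

  clSubtrail-shrink : ∀ {j U U′ w q I′} → Decidable U → U ⊆ U′ →
    ClSubtrail j U′ w q I′ → ∃[ I ] (ClSubtrail j U w q I × I ⊆ᴵ I′)
  clSubtrail-shrink {j} {U} {U′} {q = q} U? U⊆U′ sub′ with ins-extremal j U?
  ... | inj₁ none = nothing , inj₁ (none , refl) , λ _ ()
  ... | inj₂ ((lo , min) , (hi , max)) with sub′
  ...   | inj₁ (none′ , _) = ⊥-elim (none′ lo (ins-mono j {U} {U′} U⊆U′ (proj₁ min)))
  ...   | inj₂ (lo₀ , hi₀ , t , min₀ , max₀ , refl , end≤w , traced)
    with traces-sub h q (proj₂ min₀ lo (ins-mono j {U} {U′} U⊆U′ (proj₁ min)))
                        (proj₂ max lo (proj₁ min))
                        (proj₂ max₀ hi (ins-mono j {U} {U′} U⊆U′ (proj₁ max))) traced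
  ...     | t′ , traced′ , t≤t′ , end′≤end =
            just (t′ , hi ∸ lo) ,
            inj₂ (lo , hi , t′ , min , max , refl , ≤-trans end′≤end end≤w , traced′) ,
            λ i (t′≤i , i≤end′) → ≤-trans t≤t′ t′≤i , ≤-trans i≤end′ end′≤end

  clSubtrail-shrink-family : ∀ {U U′ w q} → Decidable U → U ⊆ U′ → (I′ : ℕ → Interval) →
    (∀ j → j < k → ClSubtrail j U′ w q (I′ j)) →
    Σ (ℕ → Interval) λ I → ∀ j → j < k → ClSubtrail j U w q (I j) × I j ⊆ᴵ I′ j
  clSubtrail-shrink-family {U} {U′} {w} {q} U? U⊆U′ I′ sub′ =
    (λ j → proj₁ (shrink-at j)) , (λ j j<k → proj₂ (shrink-at j) j<k)
    where
    shrink-at : ∀ j → ∃[ I ] (j < k → ClSubtrail j U w q I × I ⊆ᴵ I′ j)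
    shrink-at j with j <? k
    ... | yes j<k = let I , sub , I⊆I′ = clSubtrail-shrink {q = q} U? U⊆U′ (sub′ j j<k)
                    in I , λ _ → sub , I⊆I′
    ... | no j≮k = nothing , λ j<k → ⊥-elim (j≮k j<k)

  c3-shrink : ∀ {X X′ Y Y′ w q} → Decidable X → Decidable Y → X ⊆ X′ → Y ⊆ Y′ →
    C3For X′ Y′ w q → C3For X Y w q
  c3-shrink {q = q} X? Y? X⊆X′ Y⊆Y′ (IX′ , IY′ , subtrails , disjoint)
    with IX , shrinkX ← clSubtrail-shrink-family {q = q} X? X⊆X′ IX′ (λ j j<k → proj₁ (subtrails j j<k))
       | IY , shrinkY ← clSubtrail-shrink-family {q = q} Y? Y⊆Y′ IY′ (λ j j<k → proj₂ (subtrails j j<k))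
    = IX , IY , (λ j j<k → proj₁ (shrinkX j j<k) , proj₁ (shrinkY j j<k)) , disjoint′
    where
    disjoint′ : ∀ j j′ → j < k → j′ < k → j ≢ j′ →
      Disjoint (IX j) (IX j′) × Disjoint (IX j) (IY j′) ×
      Disjoint (IY j) (IX j′) × Disjoint (IY j) (IY j′)
    disjoint′ j j′ j<k j′<k j≢j′ =
      let dXX , dXY , dYX , dYY = disjoint j j′ j<k j′<k j≢j′
          x = proj₂ (shrinkX j j<k) ; x′ = proj₂ (shrinkX j′ j′<k)
          y = proj₂ (shrinkY j j<k) ; y′ = proj₂ (shrinkY j′ j′<k)
      in disjoint-mono x x′ dXX , disjoint-mono x y′ dXY , disjoint-mono y x′ dYX , disjoint-mono y y′ dYY

  coherent-lower-A : ∀ n m {w q} → Coherent (suc n) m w q → A (suc n) (q 0) → Coherent n m w q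
  coherent-lower-A n m {q = q} (trail , (edges , _ , end∈B) , c2 , c3) start∈A =
    trail , (edges , start∈A , end∈B) ,
    c2-shrink {A (suc n)} {A (suc (suc n))} {B (suc m)} {B (suc m)} {q = q}
      (iter-mono a (suc n)) (λ y → y) c2 ,
    c3-shrink {Y = B m} {q = q} (iter? a n) (iter? b m) (iter-mono a n) (λ y → y) c3

  coherent-lower-B : ∀ n m {w q} → Coherent n (suc m) w q → B (suc m) (q w) → Coherent n m w q
  coherent-lower-B n m {q = q} (trail , (edges , start∈A , _) , c2 , c3) end∈B =
    trail , (edges , start∈A , end∈B) ,
    c2-shrink {A (suc n)} {A (suc n)} {B (suc m)} {B (suc (suc m))} {q = q}
      (λ x → x) (iter-mono b (suc m)) c2 ,
    c3-shrink {X = A n} {q = q} (iter? a n) (iter? b m) (λ x → x) (iter-mono b m) c3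

lemma4p10 : {G : SimpleGraph} (S : Setting G) (n m w : ℕ)
    (q : ℕ → Fin (SimpleGraph.N G)) →
    SettingNotions.Coherent S n m w q →
    (1 ≤ n → SettingNotions.A S n (q 0) → SettingNotions.Coherent S (n ∸ 1) m w q) ×
    (1 ≤ m → SettingNotions.B S m (q w) → SettingNotions.Coherent S n (m ∸ 1) w q)
lemma4p10 S n m w q coherent = lower-A n coherent , lower-B m coherent
  where
  open SettingNotions S
  open Coherence S
  lower-A : ∀ n → Coherent n m w q → 1 ≤ n → A n (q 0) → Coherent (n ∸ 1) m w q
  lower-A (suc n′) coh _ = coherent-lower-A n′ m coh
  lower-B : ∀ m → Coherent n m w q → 1 ≤ m → B m (q w) → Coherent n (m ∸ 1) w q
  lower-B (suc m′) coh _ = coherent-lower-B n m′ coh
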